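{- Let $X$ be a finite set of variables. Every formula in $\mathcal{C}_1(X)$ is $\aleph_1$-continuous in $X$, i.e. for every $\phi\in\mathcal{C}_1(X)$, every $x\in X$ and every model $\mathcal{M}$, the map $S\mapsto[\![\phi]\!]_{\mathcal{M}[x\mapsto S]}$ preserves unions of $\aleph_1$-directed families of subsets of $|\mathcal{M}|$.
   Context: Fix a finite set $Act$ of actions and a countable set $Prop$ of variables. $\mathsf{L}_\mu$ is generated by $\phi ::= y \mid \neg y \mid \top \mid \phi\wedge\phi \mid \bot \mid \phi\vee\phi \mid \langle a\rangle\phi \mid [a]\phi \mid \mu_z.\phi \mid \nu_z.\phi$ ($z$ not under a negation in the fixed-point clauses), with standard Kripke semantics, $\mu/\nu$ least/greatest fixed points. A family $\mathcal{I}\subseteq P(A)$ is $\aleph_1$-directed if every countable subfamily has an upper bound in $\mathcal{I}$. For a set $X$ of variables, $\mathcal{C}_1(X)$ is generated by $\phi ::= x \mid \psi \mid \top\mid\bot\mid \phi\wedge\phi\mid\phi\vee\phi\mid\langle a\rangle\phi\mid \mu_z.\chi\mid\nu_z.\chi$, where $x\in X$, $\psi\in\mathsf{L}_\mu$ contains no variable of $X$, and $\chi\in\mathcal{C}_1(X\cup\{z\})$. -}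

module Defs where

open import Data.Nat using (ℕ; _≟_)
open import Data.Fin using (Fin)
open import Data.List using (List; _∷_)
open import Data.List.Membership.Propositional using (_∈_)
open import Data.Product using (Σ; _×_; _,_)
open import Data.Sum using (_⊎_)
open import Data.Unit using (⊤)
open import Data.Empty using (⊥)
open import Relation.Nullary using (¬_; yes; no)
open import Relation.Binary.PropositionalEquality using (_≡_; _≢_)
open import Function using (Surjective)
open import Level using (Level; 0ℓ)

-- Syntax of L_μ.  Act = Fin nA (a finite set of actions),
-- Prop = ℕ (a countable set of variables).

data Form (nA : ℕ) : Set where
  var  : ℕ → Form nA
  nvar : ℕ → Form nA
  tt   : Form nA
  ff   : Form nA
  _∧ᶠ_ : Form nA → Form nA → Form nA
  _∨ᶠ_ : Form nA → Form nA → Form nA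
  dia  : Fin nA → Form nA → Form nA
  box  : Fin nA → Form nA → Form nA
  mu   : ℕ → Form nA → Form nA
  nu   : ℕ → Form nA → Form nA

NegFree : ∀ {nA} → ℕ → Form nA → Set
NegFree z (var y)   = ⊤
NegFree z (nvar y)  = y ≢ z
NegFree z tt        = ⊤
NegFree z ff        = ⊤
NegFree z (φ ∧ᶠ ψ)  = NegFree z φ × NegFree z ψ
NegFree z (φ ∨ᶠ ψ)  = NegFree z φ × NegFree z ψ
NegFree z (dia a φ) = NegFree z φ
NegFree z (box a φ) = NegFree z φ
NegFree z (mu z' φ) = (z' ≡ z) ⊎ NegFree z φ
NegFree z (nu z' φ) = (z' ≡ z) ⊎ NegFree z φ

WF : ∀ {nA} → Form nA → Set
WF (var y)   = ⊤
WF (nvar y)  = ⊤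
WF tt        = ⊤
WF ff        = ⊤
WF (φ ∧ᶠ ψ)  = WF φ × WF ψ
WF (φ ∨ᶠ ψ)  = WF φ × WF ψ
WF (dia a φ) = WF φ
WF (box a φ) = WF φ
WF (mu z φ)  = NegFree z φ × WF φ
WF (nu z φ)  = NegFree z φ × WF φ

NotOcc : ∀ {nA} → ℕ → Form nA → Set
NotOcc x (var y)   = y ≢ x
NotOcc x (nvar y)  = y ≢ x
NotOcc x tt        = ⊤
NotOcc x ff        = ⊤
NotOcc x (φ ∧ᶠ ψ)  = NotOcc x φ × NotOcc x ψ
NotOcc x (φ ∨ᶠ ψ)  = NotOcc x φ × NotOcc x ψ
NotOcc x (dia a φ) = NotOcc x φ
NotOcc x (box a φ) = NotOcc x φ
NotOcc x (mu z φ)  = z ≢ x × NotOcc x φ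
NotOcc x (nu z φ)  = z ≢ x × NotOcc x φ

data C₁ {nA : ℕ} : List ℕ → Form nA → Set where
  c-var : ∀ {X x} → x ∈ X → C₁ X (var x)
  c-ψ   : ∀ {X ψ} → WF ψ → (∀ x → x ∈ X → NotOcc x ψ) → C₁ X ψ
  c-tt  : ∀ {X} → C₁ X tt
  c-ff  : ∀ {X} → C₁ X ff
  c-∧   : ∀ {X φ ψ} → C₁ X φ → C₁ X ψ → C₁ X (φ ∧ᶠ ψ)
  c-∨   : ∀ {X φ ψ} → C₁ X φ → C₁ X ψ → C₁ X (φ ∨ᶠ ψ)
  c-dia : ∀ {X a φ} → C₁ X φ → C₁ X (dia a φ)
  c-mu  : ∀ {X z χ} → C₁ (z ∷ X) χ → C₁ X (mu z χ)
  c-nu  : ∀ {X z χ} → C₁ (z ∷ X) χ → C₁ X (nu z χ)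

Pred : Set → Set₁
Pred W = W → Set

_⊆_ : ∀ {W} → Pred W → Pred W → Set
S ⊆ T = ∀ w → S w → T w

_≐_ : ∀ {W} → Pred W → Pred W → Set
S ≐ T = S ⊆ T × T ⊆ S

⋃ : ∀ {W} {J : Set} → (J → Pred W) → Pred W
⋃ {J = J} F w = Σ J (λ j → F j w)

record Model (nA : ℕ) : Set₁ where
  field
    W : Set
    R : Fin nA → W → W → Set
    V : ℕ → Pred W

_[_↦_] : ∀ {W : Set} → (ℕ → Pred W) → ℕ → Pred W → (ℕ → Pred W)
(V [ x ↦ S ]) y with y ≟ x
... | yes _ = S
... | no  _ = V y

_⟨_↦_⟩ : ∀ {nA} (M : Model nA) → ℕ → Pred (Model.W M) → Model nA
M ⟨ x ↦ S ⟩ = record { W = Model.W M ; R = Model.R M ; V = Model.V M [ x ↦ S ] }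

-- Semantics, relationally: Den R V φ T means "T is (up to extensional
-- equality) the denotation [[φ]] in the model with relations R and valuation V".
-- μ: T is a fixed point contained in every pre-fixed point;
-- ν: T is a fixed point containing every post-fixed point.

Den : ∀ {nA} {W : Set} → (Fin nA → W → W → Set) → (ℕ → Pred W) →
      Form nA → Pred W → Set₁
Den R V (var y)   T = Level.Lift (Level.suc 0ℓ) (T ≐ V y)
Den R V (nvar y)  T = Level.Lift (Level.suc 0ℓ) (T ≐ (λ w → ¬ V y w))
Den R V tt        T = Level.Lift (Level.suc 0ℓ) (T ≐ (λ _ → ⊤))
Den R V ff        T = Level.Lift (Level.suc 0ℓ) (T ≐ (λ _ → ⊥))
Den R V (φ ∧ᶠ ψ)  T = Σ _ λ T₁ → Σ _ λ T₂ → Den R V φ T₁ × Den R V ψ T₂ ×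
                        Level.Lift (Level.suc 0ℓ) (T ≐ (λ w → T₁ w × T₂ w))
Den R V (φ ∨ᶠ ψ)  T = Σ _ λ T₁ → Σ _ λ T₂ → Den R V φ T₁ × Den R V ψ T₂ ×
                        Level.Lift (Level.suc 0ℓ) (T ≐ (λ w → T₁ w ⊎ T₂ w))
Den {W = W} R V (dia a φ) T = Σ _ λ T₁ → Den R V φ T₁ ×
                        Level.Lift (Level.suc 0ℓ) (T ≐ (λ w → Σ W λ v → R a w v × T₁ v))
Den {W = W} R V (box a φ) T = Σ _ λ T₁ → Den R V φ T₁ ×
                        Level.Lift (Level.suc 0ℓ) (T ≐ (λ w → ∀ v → R a w v → T₁ v))
Den R V (mu z φ)  T = Den R (V [ z ↦ T ]) φ T ×
                      (∀ S U → Den R (V [ z ↦ S ]) φ U → U ⊆ S → Level.Lift (Level.suc 0ℓ) (T ⊆ S))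
Den R V (nu z φ)  T = Den R (V [ z ↦ T ]) φ T ×
                      (∀ S U → Den R (V [ z ↦ S ]) φ U → S ⊆ U → Level.Lift (Level.suc 0ℓ) (S ⊆ T))

IsDen : ∀ {nA} (M : Model nA) → Form nA → Pred (Model.W M) → Set₁
IsDen M φ T = Den (Model.R M) (Model.V M) φ T

Countable : Set → Set
Countable C = ¬ C ⊎ Σ (ℕ → C) (λ s → Surjective _≡_ _≡_ s)

Aleph1Directed : ∀ {W : Set} {J : Set} → (J → Pred W) → Set₁
Aleph1Directed {J = J} F =
  ∀ (C : Set) (e : C → J) → Countable C → Σ J (λ j → ∀ c → F (e c) ⊆ F j)

-- The invariant, proved by induction on C₁(X), is that along valuations
-- differing from a fixed one only on X, denotations exist, are monotone and
-- preserve unions of ℵ₁-directed families of valuations.  Conjunction needs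
-- directedness to merge two witnesses, and everything else is pointwise
-- except the fixed points.  If the body is ℵ₁-continuous, the least fixed
-- point is reached by iterating along countably branching ordinals, since
-- countable sets of stages are bounded by a stage; and every post-fixed
-- point is covered by countable post-fixed points, so the greatest fixed
-- point is the union of the countable ones.  Continuity of μ then follows
-- from leastness, and that of ν because a countable post-fixed set of the
-- limit is already post-fixed for a single member of the family.

module Submission where

open import Defs
open import Data.Nat using (ℕ; zero; suc; _+_; _≟_)
open import Data.Nat.Properties using (+-suc; +-identityʳ)
open import Data.Fin using (Fin)
open import Data.List using (List; []; _∷_)
open import Data.List.Membership.Propositional using (_∈_; _∉_)
open import Data.List.Relation.Unary.Any using (here; there)
open import Data.Product using (Σ; ∃; _×_; _,_; proj₁; proj₂; uncurry)
open import Data.Sum using (_⊎_; inj₁; inj₂)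
open import Data.Unit using (tt)
open import Data.Empty using (⊥; ⊥-elim)
open import Data.Bool using (Bool; true; false; if_then_else_)
open import Function using (_∘_; id; const)
open import Level using (lift; lower)
open import Relation.Nullary using (¬_; yes; no)
open import Relation.Binary.PropositionalEquality using (_≡_; refl; sym; trans; cong; subst)

nextPair : ℕ × ℕ → ℕ × ℕ
nextPair (a , zero)  = zero , suc a
nextPair (a , suc b) = suc a , b

unpair : ℕ → ℕ × ℕ
unpair zero    = zero , zero
unpair (suc n) = nextPair (unpair n)

unpair-onto-antidiagonal : ∀ d a b → a + b ≡ d → ∃ λ n → unpair n ≡ (a , b)
unpair-onto-antidiagonal _ zero zero _ = zero , refl
unpair-onto-antidiagonal .(suc b) zero (suc b) refl =
  let n , eq = unpair-onto-antidiagonal b b zero (+-identityʳ b) in suc n , cong nextPair eq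
unpair-onto-antidiagonal d (suc a) b a+b≡d =
  let n , eq = unpair-onto-antidiagonal d a (suc b) (trans (+-suc a b) a+b≡d) in suc n , cong nextPair eq

unpair-surjective : ∀ a b → ∃ λ n → unpair n ≡ (a , b)
unpair-surjective a b = unpair-onto-antidiagonal (a + b) a b refl

countable-ℕ : Countable ℕ
countable-ℕ = inj₂ (id , λ n → n , id)

countable-Bool : Countable Bool
countable-Bool = inj₂ (isSuc , λ { false → 0 , λ { refl → refl } ; true → 1 , λ { refl → refl } })
  where
    isSuc : ℕ → Bool
    isSuc zero    = false
    isSuc (suc _) = true

countable-⊥ : Countable ⊥
countable-⊥ = inj₁ id

module _ {W : Set} where

  ⊆-refl : {S : Pred W} → S ⊆ S
  ⊆-refl _ p = p

  ≐-refl : {S : Pred W} → S ≐ S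
  ≐-refl = ⊆-refl , ⊆-refl

  ≐-sym : {S T : Pred W} → S ≐ T → T ≐ S
  ≐-sym (S⊆T , T⊆S) = T⊆S , S⊆T

  ≐-trans : {S T U : Pred W} → S ≐ T → T ≐ U → S ≐ U
  ≐-trans (S⊆T , T⊆S) (T⊆U , U⊆T) = (λ w → T⊆U w ∘ S⊆T w) , (λ w → T⊆S w ∘ U⊆T w)

  ¬-cong-≐ : {S T : Pred W} → S ≐ T → (λ w → ¬ S w) ≐ (λ w → ¬ T w)
  ¬-cong-≐ (S⊆T , T⊆S) = (λ w ¬Sw → ¬Sw ∘ T⊆S w) , (λ w ¬Tw → ¬Tw ∘ S⊆T w)

  aleph1Directed-index : {J : Set} {F : J → Pred W} → Aleph1Directed F → J
  aleph1Directed-index dir = proj₁ (dir ⊥ ⊥-elim countable-⊥)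

module _ {A : Set} where

  range : (ℕ → A) → Pred A
  range t a = ∃ λ n → t n ≡ a

  interleave : (ℕ → ℕ → A) → ℕ → A
  interleave u = uncurry u ∘ unpair

  range-interleave⁺ : ∀ u m → range (u m) ⊆ range (interleave u)
  range-interleave⁺ u m a (n , eq) =
    let k , unpair-k = unpair-surjective m n in k , trans (cong (uncurry u) unpair-k) eq

  range-interleave⁻ : ∀ u → range (interleave u) ⊆ ⋃ (λ m → range (u m))
  range-interleave⁻ u a (k , eq) = proj₁ (unpair k) , proj₂ (unpair k) , eq

module _ {W : Set} {S : Pred W} where

  enumerations-cover : S ⊆ ⋃ (λ (t : ℕ → Σ W S) → range (proj₁ ∘ t))
  enumerations-cover v v∈S = const (v , v∈S) , 0 , refl

  enumerations-directed : Σ W S → Aleph1Directed (λ (t : ℕ → Σ W S) → range (proj₁ ∘ t))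
  enumerations-directed s₀ C e (inj₁ ¬C) = const s₀ , λ c → ⊥-elim (¬C c)
  enumerations-directed s₀ C e (inj₂ (s , s-onto)) = interleave (e ∘ s) , bound
    where
      bound : ∀ c → range (proj₁ ∘ e c) ⊆ range (proj₁ ∘ interleave (e ∘ s))
      bound c = subst (λ c′ → range (proj₁ ∘ e c′) ⊆ range (proj₁ ∘ interleave (e ∘ s)))
                      (proj₂ (s-onto c) refl)
                      (range-interleave⁺ (λ n → proj₁ ∘ e (s n)) (proj₁ (s-onto c)))

module FixedPoints {W : Set} (f : Pred W → Pred W)
  (f-mono : ∀ {S S′} → S ⊆ S′ → f S ⊆ f S′)
  (f-cont : ∀ {J : Set} (F : J → Pred W) → Aleph1Directed F → f (⋃ F) ⊆ ⋃ (f ∘ F)) where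

  data Ordinal : Set where
    zero : Ordinal
    suc  : Ordinal → Ordinal
    lim  : (ℕ → Ordinal) → Ordinal

  stage : Ordinal → Pred W
  stage zero    _ = ⊥
  stage (suc α) = f (stage α)
  stage (lim α) = ⋃ (stage ∘ α)

  stages-directed : Aleph1Directed stage
  stages-directed C e (inj₁ ¬C) = zero , λ c → ⊥-elim (¬C c)
  stages-directed C e (inj₂ (s , s-onto)) = lim (e ∘ s) , λ c w w∈ →
    proj₁ (s-onto c) , subst (λ c′ → stage (e c′) w) (sym (proj₂ (s-onto c) refl)) w∈

  lfp : Pred W
  lfp = ⋃ stage

  stage⊆pre-fixed : ∀ {S} → f S ⊆ S → ∀ α → stage α ⊆ S
  stage⊆pre-fixed pre zero    w ()
  stage⊆pre-fixed pre (suc α) w p       = pre w (f-mono (stage⊆pre-fixed pre α) w p)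
  stage⊆pre-fixed pre (lim α) w (n , p) = stage⊆pre-fixed pre (α n) w p

  lfp-least : ∀ {S} → f S ⊆ S → lfp ⊆ S
  lfp-least pre w (α , p) = stage⊆pre-fixed pre α w p

  stage⊆f-lfp : ∀ α → stage α ⊆ f lfp
  stage⊆f-lfp zero    w ()
  stage⊆f-lfp (suc α) w p       = f-mono (λ v q → α , q) w p
  stage⊆f-lfp (lim α) w (n , p) = stage⊆f-lfp (α n) w p

  lfp-fixed : f lfp ≐ lfp
  lfp-fixed = (λ w p → let α , q = f-cont stage stages-directed w p in suc α , q)
            , (λ w (α , p) → stage⊆f-lfp α w p)

  -- The union of all post-fixed points would be Set₁-valued; by continuity the countable ones suffice.
  gfp : Pred W
  gfp w = ∃ λ (t : ℕ → W) → range t w × range t ⊆ f (range t)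

  countable-support : ∀ {S v} → Σ W S → f S v → ∃ λ (t : ℕ → Σ W S) → f (range (proj₁ ∘ t)) v
  countable-support s₀ v∈fS =
    f-cont _ (enumerations-directed s₀) _ (f-mono enumerations-cover _ v∈fS)

  post-fixed⊆gfp : ∀ {S} → S ⊆ f S → S ⊆ gfp
  post-fixed⊆gfp {S} post w w∈S = t , range-interleave⁺ layerᵂ 0 w (0 , refl) , t-post
    where
      children : Σ W S → ℕ → Σ W S
      children (v , v∈S) = proj₁ (countable-support (w , w∈S) (post v v∈S))

      layer : ℕ → ℕ → Σ W S
      layer zero    = const (w , w∈S)
      layer (suc k) = interleave (children ∘ layer k)

      layerᵂ : ℕ → ℕ → W
      layerᵂ k = proj₁ ∘ layer k

      t : ℕ → W
      t = interleave layerᵂ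

      children⊆t : ∀ k m → range (proj₁ ∘ children (layer k m)) ⊆ range t
      children⊆t k m v v∈ = range-interleave⁺ layerᵂ (suc k) v
        (range-interleave⁺ (λ n → proj₁ ∘ children (layer k n)) m v v∈)

      t-post : range t ⊆ f (range t)
      t-post v v∈t with range-interleave⁻ layerᵂ v v∈t
      ... | k , m , refl = f-mono (children⊆t k m) v
        (proj₂ (countable-support (w , w∈S) (post v (proj₂ (layer k m)))))

  gfp-post-fixed : gfp ⊆ f gfp
  gfp-post-fixed w (t , w∈t , t-post) = f-mono (λ v v∈t → t , v∈t , t-post) w (t-post w w∈t)

  gfp-fixed : f gfp ≐ gfp
  gfp-fixed = post-fixed⊆gfp (f-mono gfp-post-fixed) , gfp-post-fixed

Valuation : Set → Set₁
Valuation W = ℕ → Pred W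

module _ {W : Set} where

  infix 4 _≤ᵛ_ _≐ᵛ_

  _≤ᵛ_ : Valuation W → Valuation W → Set
  V ≤ᵛ V′ = ∀ y → V y ⊆ V′ y

  _≐ᵛ_ : Valuation W → Valuation W → Set
  V ≐ᵛ V′ = ∀ y → V y ≐ V′ y

  AgreeOutside : List ℕ → Valuation W → Valuation W → Set
  AgreeOutside X V V′ = ∀ y → y ∉ X → V y ≐ V′ y

  ≤ᵛ-refl : {V : Valuation W} → V ≤ᵛ V
  ≤ᵛ-refl _ = ⊆-refl

  ≐ᵛ-refl : {V : Valuation W} → V ≐ᵛ V
  ≐ᵛ-refl _ = ≐-refl

  ≐ᵛ-sym : {V V′ : Valuation W} → V ≐ᵛ V′ → V′ ≐ᵛ V
  ≐ᵛ-sym V≐V′ = ≐-sym ∘ V≐V′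

  agreeOutside-sym : ∀ {X} {V V′ : Valuation W} → AgreeOutside X V V′ → AgreeOutside X V′ V
  agreeOutside-sym a y y∉X = ≐-sym (a y y∉X)

  agreeOutside-trans : ∀ {X} {V V′ V″ : Valuation W} →
                       AgreeOutside X V V′ → AgreeOutside X V′ V″ → AgreeOutside X V V″
  agreeOutside-trans a a′ y y∉X = ≐-trans (a y y∉X) (a′ y y∉X)

  agreeOutside-∷ : ∀ {X z} {V V′ : Valuation W} → AgreeOutside X V V′ → AgreeOutside (z ∷ X) V V′
  agreeOutside-∷ a y y∉z∷X = a y (y∉z∷X ∘ there)

  update-≤ᵛ : ∀ {z} {V V′ : Valuation W} {S S′} → V ≤ᵛ V′ → S ⊆ S′ → V [ z ↦ S ] ≤ᵛ V′ [ z ↦ S′ ]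
  update-≤ᵛ {z} V≤V′ S⊆S′ y with y ≟ z
  ... | yes _ = S⊆S′
  ... | no  _ = V≤V′ y

  update-≐ᵛ : ∀ {z} {V V′ : Valuation W} {S S′} → V ≐ᵛ V′ → S ≐ S′ → V [ z ↦ S ] ≐ᵛ V′ [ z ↦ S′ ]
  update-≐ᵛ {z} V≐V′ S≐S′ y with y ≟ z
  ... | yes _ = S≐S′
  ... | no  _ = V≐V′ y

  agreeOutside-update∉ : ∀ {X z} {V V′ : Valuation W} {S S′} → z ∉ X → AgreeOutside X V V′ → S ≐ S′ →
                         AgreeOutside X (V [ z ↦ S ]) (V′ [ z ↦ S′ ])
  agreeOutside-update∉ {z = z} z∉X a S≐S′ y y∉X with y ≟ z
  ... | yes _ = S≐S′
  ... | no  _ = a y y∉X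

  agreeOutside-update∈ : ∀ {X z} {V V′ : Valuation W} {S S′} → z ∈ X → AgreeOutside X V V′ →
                         AgreeOutside X (V [ z ↦ S ]) (V′ [ z ↦ S′ ])
  agreeOutside-update∈ {X} {z} z∈X a y y∉X with y ≟ z
  ... | yes y≡z = ⊥-elim (y∉X (subst (_∈ X) (sym y≡z) z∈X))
  ... | no  _   = a y y∉X

  agreeOutside-update∷ : ∀ {X z} {V V′ : Valuation W} {S S′} → AgreeOutside X V V′ →
                         AgreeOutside (z ∷ X) (V [ z ↦ S ]) (V′ [ z ↦ S′ ])
  agreeOutside-update∷ a = agreeOutside-update∈ (here refl) (agreeOutside-∷ a)

module Semantics {nA : ℕ} {W : Set} (R : Fin nA → W → W → Set) where

  Den-transport : ∀ {X} φ {V V′ : Valuation W} {T T′} → (∀ x → x ∈ X → NotOcc x φ) →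
                  AgreeOutside X V V′ → T ≐ T′ → Den R V φ T → Den R V′ φ T′
  Den-transport (var y) fresh a T≐T′ (lift d) =
    lift (≐-trans (≐-sym T≐T′) (≐-trans d (a y λ y∈X → fresh y y∈X refl)))
  Den-transport (nvar y) fresh a T≐T′ (lift d) =
    lift (≐-trans (≐-sym T≐T′) (≐-trans d (¬-cong-≐ (a y λ y∈X → fresh y y∈X refl))))
  Den-transport tt fresh a T≐T′ (lift d) = lift (≐-trans (≐-sym T≐T′) d)
  Den-transport ff fresh a T≐T′ (lift d) = lift (≐-trans (≐-sym T≐T′) d)
  Den-transport (φ ∧ᶠ ψ) fresh a T≐T′ (T₁ , T₂ , d₁ , d₂ , lift e) =
    T₁ , T₂ , Den-transport φ (λ x → proj₁ ∘ fresh x) a ≐-refl d₁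
            , Den-transport ψ (λ x → proj₂ ∘ fresh x) a ≐-refl d₂ , lift (≐-trans (≐-sym T≐T′) e)
  Den-transport (φ ∨ᶠ ψ) fresh a T≐T′ (T₁ , T₂ , d₁ , d₂ , lift e) =
    T₁ , T₂ , Den-transport φ (λ x → proj₁ ∘ fresh x) a ≐-refl d₁
            , Den-transport ψ (λ x → proj₂ ∘ fresh x) a ≐-refl d₂ , lift (≐-trans (≐-sym T≐T′) e)
  Den-transport (dia b φ) fresh a T≐T′ (T₁ , d , lift e) =
    T₁ , Den-transport φ fresh a ≐-refl d , lift (≐-trans (≐-sym T≐T′) e)
  Den-transport (box b φ) fresh a T≐T′ (T₁ , d , lift e) =
    T₁ , Den-transport φ fresh a ≐-refl d , lift (≐-trans (≐-sym T≐T′) e)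
  Den-transport {X} (mu z φ) {V} {V′} fresh a T≐T′ (d , least) =
    Den-transport φ fresh′ (agreeOutside-update∉ z∉X a T≐T′) T≐T′ d ,
    λ S U d′ U⊆S → lift λ w p → lower (least S U (back d′) U⊆S) w (proj₂ T≐T′ w p)
    where
      fresh′ : ∀ x → x ∈ X → NotOcc x φ
      fresh′ x = proj₂ ∘ fresh x
      z∉X : z ∉ X
      z∉X z∈X = proj₁ (fresh z z∈X) refl
      back : ∀ {S U} → Den R (V′ [ z ↦ S ]) φ U → Den R (V [ z ↦ S ]) φ U
      back = Den-transport φ fresh′ (agreeOutside-update∉ z∉X (agreeOutside-sym a) ≐-refl) ≐-refl
  Den-transport {X} (nu z φ) {V} {V′} fresh a T≐T′ (d , greatest) =
    Den-transport φ fresh′ (agreeOutside-update∉ z∉X a T≐T′) T≐T′ d ,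
    λ S U d′ S⊆U → lift λ w p → proj₁ T≐T′ w (lower (greatest S U (back d′) S⊆U) w p)
    where
      fresh′ : ∀ x → x ∈ X → NotOcc x φ
      fresh′ x = proj₂ ∘ fresh x
      z∉X : z ∉ X
      z∉X z∈X = proj₁ (fresh z z∈X) refl
      back : ∀ {S U} → Den R (V′ [ z ↦ S ]) φ U → Den R (V [ z ↦ S ]) φ U
      back = Den-transport φ fresh′ (agreeOutside-update∉ z∉X (agreeOutside-sym a) ≐-refl) ≐-refl

  Den-cong : ∀ φ {V V′ : Valuation W} {T T′} → V ≐ᵛ V′ → T ≐ T′ → Den R V φ T → Den R V′ φ T′
  Den-cong φ V≐V′ = Den-transport {[]} φ (λ _ ()) (λ y _ → V≐V′ y)

  Den-unique : ∀ φ {V V′ : Valuation W} {T T′} → V ≐ᵛ V′ → Den R V φ T → Den R V′ φ T′ → T ⊆ T′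
  Den-unique (var y) V≐V′ (lift d) (lift d′) w p = proj₂ d′ w (proj₁ (V≐V′ y) w (proj₁ d w p))
  Den-unique (nvar y) V≐V′ (lift d) (lift d′) w p = proj₂ d′ w (proj₁ d w p ∘ proj₂ (V≐V′ y) w)
  Den-unique tt V≐V′ _ (lift d′) w p = proj₂ d′ w tt
  Den-unique ff V≐V′ (lift d) _ w p = ⊥-elim (proj₁ d w p)
  Den-unique (φ ∧ᶠ ψ) V≐V′ (_ , _ , d₁ , d₂ , lift e) (_ , _ , d₁′ , d₂′ , lift e′) w p =
    let q₁ , q₂ = proj₁ e w p in
    proj₂ e′ w (Den-unique φ V≐V′ d₁ d₁′ w q₁ , Den-unique ψ V≐V′ d₂ d₂′ w q₂)
  Den-unique (φ ∨ᶠ ψ) V≐V′ (_ , _ , d₁ , d₂ , lift e) (_ , _ , d₁′ , d₂′ , lift e′) w p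
    with proj₁ e w p
  ... | inj₁ q = proj₂ e′ w (inj₁ (Den-unique φ V≐V′ d₁ d₁′ w q))
  ... | inj₂ q = proj₂ e′ w (inj₂ (Den-unique ψ V≐V′ d₂ d₂′ w q))
  Den-unique (dia b φ) V≐V′ (_ , d , lift e) (_ , d′ , lift e′) w p =
    let v , r , q = proj₁ e w p in proj₂ e′ w (v , r , Den-unique φ V≐V′ d d′ v q)
  Den-unique (box b φ) V≐V′ (_ , d , lift e) (_ , d′ , lift e′) w p =
    proj₂ e′ w λ v r → Den-unique φ V≐V′ d d′ v (proj₁ e w p v r)
  Den-unique (mu z φ) V≐V′ (_ , least) (d′ , _) =
    lower (least _ _ (Den-cong φ (update-≐ᵛ (≐ᵛ-sym V≐V′) ≐-refl) ≐-refl d′) ⊆-refl)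
  Den-unique (nu z φ) V≐V′ (d , _) (_ , greatest) =
    lower (greatest _ _ (Den-cong φ (update-≐ᵛ V≐V′ ≐-refl) ≐-refl d) ⊆-refl)

  record DirectedUnion (X : List ℕ) (V₀ : Valuation W) {J : Set}
                       (Vs : J → Valuation W) (V∞ : Valuation W) : Set₁ where
    field
      directed      : ∀ (C : Set) (e : C → J) → Countable C → Σ J λ j → ∀ c → Vs (e c) ≤ᵛ Vs j
      union         : V∞ ≐ᵛ (λ y → ⋃ λ j → Vs j y)
      members-agree : ∀ j → AgreeOutside X (Vs j) V₀
      union-agrees  : AgreeOutside X V∞ V₀

    index : J
    index = proj₁ (directed ⊥ ⊥-elim countable-⊥)

    upper-bound₂ : ∀ i j → Σ J λ k → Vs i ≤ᵛ Vs k × Vs j ≤ᵛ Vs k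
    upper-bound₂ i j =
      let k , bound = directed Bool (λ b → if b then i else j) countable-Bool in k , bound true , bound false

  open DirectedUnion

  update-directedUnion : ∀ {X x J} {V V₀ : Valuation W} {T₀} {Ss : J → Pred W} →
                         x ∈ X → AgreeOutside X V V₀ → Aleph1Directed Ss →
                         DirectedUnion X (V₀ [ x ↦ T₀ ]) (λ j → V [ x ↦ Ss j ]) (V [ x ↦ ⋃ Ss ])
  update-directedUnion {x = x} {V = V} {Ss = Ss} x∈X a dir = record
    { directed      = λ C e countable → let j , bound = dir C e countable in
                                        j , λ c → update-≤ᵛ ≤ᵛ-refl (bound c)
    ; union         = union′
    ; members-agree = λ _ → agreeOutside-update∈ x∈X a
    ; union-agrees  = agreeOutside-update∈ x∈X a
    }
    where
      union′ : V [ x ↦ ⋃ Ss ] ≐ᵛ (λ y → ⋃ λ j → (V [ x ↦ Ss j ]) y)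
      union′ y with y ≟ x
      ... | yes _ = ≐-refl
      ... | no  _ = (λ w p → aleph1Directed-index dir , p) , (λ w → proj₂)

  directedUnion-update∷ : ∀ {X z J} {V₀ V∞ : Valuation W} {Vs : J → Valuation W} {T₀ S∞} {Ss : J → Pred W} →
                         DirectedUnion X V₀ Vs V∞ → (∀ {i j} → Vs i ≤ᵛ Vs j → Ss i ⊆ Ss j) → S∞ ≐ ⋃ Ss →
                         DirectedUnion (z ∷ X) (V₀ [ z ↦ T₀ ]) (λ j → Vs j [ z ↦ Ss j ]) (V∞ [ z ↦ S∞ ])
  directedUnion-update∷ {z = z} {V∞ = V∞} {Vs} {S∞ = S∞} {Ss} du compatible S∞≐ = record
    { directed      = λ C e countable → let k , bound = directed du C e countable in
                                        k , λ c → update-≤ᵛ (bound c) (compatible (bound c))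
    ; union         = union′
    ; members-agree = λ j → agreeOutside-update∷ (members-agree du j)
    ; union-agrees  = agreeOutside-update∷ (union-agrees du)
    }
    where
      union′ : V∞ [ z ↦ S∞ ] ≐ᵛ (λ y → ⋃ λ j → (Vs j [ z ↦ Ss j ]) y)
      union′ y with y ≟ z
      ... | yes _ = S∞≐
      ... | no  _ = union du y

  -- Den is only a relation, so existence of denotations is part of the invariant.
  record Continuous (X : List ℕ) (φ : Form nA) (V₀ : Valuation W) : Set₁ where
    field
      exists : ∀ V → AgreeOutside X V V₀ → ∃ (Den R V φ)
      mono   : ∀ {V V′ T T′} → AgreeOutside X V V₀ → AgreeOutside X V′ V₀ → V ≤ᵛ V′ →
               Den R V φ T → Den R V′ φ T′ → T ⊆ T′
      cont   : ∀ {J} {Vs : J → Valuation W} {V∞ T} {D : J → Pred W} → DirectedUnion X V₀ Vs V∞ →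
               Den R V∞ φ T → (∀ j → Den R (Vs j) φ (D j)) → T ⊆ ⋃ D

  open Continuous

  var-continuous : ∀ {X x V₀} → Continuous X (var x) V₀
  var-continuous {x = x} = record
    { exists = λ V _ → V x , lift ≐-refl
    ; mono   = λ { _ _ V≤V′ (lift d) (lift d′) w p → proj₂ d′ w (V≤V′ x w (proj₁ d w p)) }
    ; cont   = λ { du (lift d) Ds w p → let j , q = proj₁ (union du x) w (proj₁ d w p) in
                                        j , proj₂ (lower (Ds j)) w q }
    }

  closed-continuous : ∀ {X ψ V₀ T₀} → (∀ x → x ∈ X → NotOcc x ψ) → Den R V₀ ψ T₀ → Continuous X ψ V₀
  closed-continuous {X} {ψ} {V₀} {T₀} fresh d₀ = record
    { exists = λ V a → T₀ , Den-transport ψ fresh (agreeOutside-sym a) ≐-refl d₀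
    ; mono   = λ a a′ _ → same a a′
    ; cont   = λ du d Ds w p →
        index du , same (union-agrees du) (members-agree du (index du)) d (Ds (index du)) w p
    }
    where
      same : ∀ {V V′ T T′} → AgreeOutside X V V₀ → AgreeOutside X V′ V₀ →
             Den R V ψ T → Den R V′ ψ T′ → T ⊆ T′
      same a a′ d = Den-unique ψ ≐ᵛ-refl
        (Den-transport ψ fresh (agreeOutside-trans a (agreeOutside-sym a′)) ≐-refl d)

  tt-continuous : ∀ {X V₀} → Continuous X tt V₀
  tt-continuous = record
    { exists = λ _ _ → _ , lift ≐-refl
    ; mono   = λ { _ _ _ _ (lift d′) w _ → proj₂ d′ w tt }
    ; cont   = λ du _ Ds w _ → index du , proj₂ (lower (Ds (index du))) w tt
    }

  ff-continuous : ∀ {X V₀} → Continuous X ff V₀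
  ff-continuous = record
    { exists = λ _ _ → _ , lift ≐-refl
    ; mono   = λ { _ _ _ (lift d) _ w p → ⊥-elim (proj₁ d w p) }
    ; cont   = λ { _ (lift d) _ w p → ⊥-elim (proj₁ d w p) }
    }

  ∧-continuous : ∀ {X φ ψ V₀} → Continuous X φ V₀ → Continuous X ψ V₀ → Continuous X (φ ∧ᶠ ψ) V₀
  ∧-continuous {X} {φ} {ψ} {V₀} Iφ Iψ = record
    { exists = λ V a → let A , dA = exists Iφ V a ; B , dB = exists Iψ V a in
                       _ , A , B , dA , dB , lift ≐-refl
    ; mono   = λ a a′ V≤V′ d d′ w p → let q₁ , q₂ = ∧-elim d w p in
        ∧-intro d′ w (mono Iφ a a′ V≤V′ (den₁ d) (den₁ d′) w q₁) (mono Iψ a a′ V≤V′ (den₂ d) (den₂ d′) w q₂)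
    ; cont   = cont′
    }
    where
      den₁ : ∀ {V T} (d : Den R V (φ ∧ᶠ ψ) T) → Den R V φ (proj₁ d)
      den₁ (_ , _ , d₁ , _) = d₁
      den₂ : ∀ {V T} (d : Den R V (φ ∧ᶠ ψ) T) → Den R V ψ (proj₁ (proj₂ d))
      den₂ (_ , _ , _ , d₂ , _) = d₂
      ∧-elim : ∀ {V T} (d : Den R V (φ ∧ᶠ ψ) T) → T ⊆ (λ w → proj₁ d w × proj₁ (proj₂ d) w)
      ∧-elim (_ , _ , _ , _ , lift e) = proj₁ e
      ∧-intro : ∀ {V T} (d : Den R V (φ ∧ᶠ ψ) T) → ∀ w → proj₁ d w → proj₁ (proj₂ d) w → T w
      ∧-intro (_ , _ , _ , _ , lift e) w q₁ q₂ = proj₂ e w (q₁ , q₂)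

      cont′ : ∀ {J} {Vs : J → Valuation W} {V∞ T} {D : J → Pred W} → DirectedUnion X V₀ Vs V∞ →
              Den R V∞ (φ ∧ᶠ ψ) T → (∀ j → Den R (Vs j) (φ ∧ᶠ ψ) (D j)) → T ⊆ ⋃ D
      cont′ du d Ds w p =
        let q₁ , q₂   = ∧-elim d w p
            i , r₁    = cont Iφ du (den₁ d) (den₁ ∘ Ds) w q₁
            j , r₂    = cont Iψ du (den₂ d) (den₂ ∘ Ds) w q₂
            k , i≤k , j≤k = upper-bound₂ du i j
            agrees = members-agree du
        in k , ∧-intro (Ds k) w (mono Iφ (agrees i) (agrees k) i≤k (den₁ (Ds i)) (den₁ (Ds k)) w r₁)
                                (mono Iψ (agrees j) (agrees k) j≤k (den₂ (Ds j)) (den₂ (Ds k)) w r₂)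

  ∨-continuous : ∀ {X φ ψ V₀} → Continuous X φ V₀ → Continuous X ψ V₀ → Continuous X (φ ∨ᶠ ψ) V₀
  ∨-continuous {X} {φ} {ψ} {V₀} Iφ Iψ = record
    { exists = λ V a → let A , dA = exists Iφ V a ; B , dB = exists Iψ V a in
                       _ , A , B , dA , dB , lift ≐-refl
    ; mono   = mono′
    ; cont   = cont′
    }
    where
      den₁ : ∀ {V T} (d : Den R V (φ ∨ᶠ ψ) T) → Den R V φ (proj₁ d)
      den₁ (_ , _ , d₁ , _) = d₁
      den₂ : ∀ {V T} (d : Den R V (φ ∨ᶠ ψ) T) → Den R V ψ (proj₁ (proj₂ d))
      den₂ (_ , _ , _ , d₂ , _) = d₂
      ∨-elim : ∀ {V T} (d : Den R V (φ ∨ᶠ ψ) T) → ∀ w → T w → proj₁ d w ⊎ proj₁ (proj₂ d) w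
      ∨-elim (_ , _ , _ , _ , lift e) = proj₁ e
      ∨-intro : ∀ {V T} (d : Den R V (φ ∨ᶠ ψ) T) → ∀ w → proj₁ d w ⊎ proj₁ (proj₂ d) w → T w
      ∨-intro (_ , _ , _ , _ , lift e) = proj₂ e

      mono′ : ∀ {V V′ T T′} → AgreeOutside X V V₀ → AgreeOutside X V′ V₀ → V ≤ᵛ V′ →
              Den R V (φ ∨ᶠ ψ) T → Den R V′ (φ ∨ᶠ ψ) T′ → T ⊆ T′
      mono′ a a′ V≤V′ d d′ w p with ∨-elim d w p
      ... | inj₁ q = ∨-intro d′ w (inj₁ (mono Iφ a a′ V≤V′ (den₁ d) (den₁ d′) w q))
      ... | inj₂ q = ∨-intro d′ w (inj₂ (mono Iψ a a′ V≤V′ (den₂ d) (den₂ d′) w q))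

      cont′ : ∀ {J} {Vs : J → Valuation W} {V∞ T} {D : J → Pred W} → DirectedUnion X V₀ Vs V∞ →
              Den R V∞ (φ ∨ᶠ ψ) T → (∀ j → Den R (Vs j) (φ ∨ᶠ ψ) (D j)) → T ⊆ ⋃ D
      cont′ du d Ds w p with ∨-elim d w p
      ... | inj₁ q = let j , r = cont Iφ du (den₁ d) (den₁ ∘ Ds) w q in j , ∨-intro (Ds j) w (inj₁ r)
      ... | inj₂ q = let j , r = cont Iψ du (den₂ d) (den₂ ∘ Ds) w q in j , ∨-intro (Ds j) w (inj₂ r)

  dia-continuous : ∀ {X b φ V₀} → Continuous X φ V₀ → Continuous X (dia b φ) V₀
  dia-continuous {X} {b} {φ} {V₀} Iφ = record
    { exists = λ V a → let A , dA = exists Iφ V a in _ , A , dA , lift ≐-refl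
    ; mono   = λ a a′ V≤V′ d d′ w p → let v , r , q = dia-elim d w p in
                                      dia-intro d′ w v r (mono Iφ a a′ V≤V′ (den d) (den d′) v q)
    ; cont   = λ du d Ds w p → let v , r , q = dia-elim d w p
                                   j , s = cont Iφ du (den d) (den ∘ Ds) v q in
                               j , dia-intro (Ds j) w v r s
    }
    where
      den : ∀ {V T} (d : Den R V (dia b φ) T) → Den R V φ (proj₁ d)
      den (_ , d , _) = d
      dia-elim : ∀ {V T} (d : Den R V (dia b φ) T) → ∀ w → T w → Σ W λ v → R b w v × proj₁ d v
      dia-elim (_ , _ , lift e) = proj₁ e
      dia-intro : ∀ {V T} (d : Den R V (dia b φ) T) → ∀ w v → R b w v → proj₁ d v → T w
      dia-intro (_ , _ , lift e) w v r q = proj₂ e w (v , r , q)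

  module FixedPointBody {X z χ} {V₀ : Valuation W} {T₀} (I : Continuous (z ∷ X) χ (V₀ [ z ↦ T₀ ]))
                        {V : Valuation W} (a : AgreeOutside X V V₀) where

    step : Pred W → Pred W
    step S = proj₁ (exists I (V [ z ↦ S ]) (agreeOutside-update∷ a))

    step-den : ∀ S → Den R (V [ z ↦ S ]) χ (step S)
    step-den S = proj₂ (exists I (V [ z ↦ S ]) (agreeOutside-update∷ a))

    step-mono : ∀ {S S′} → S ⊆ S′ → step S ⊆ step S′
    step-mono S⊆S′ = mono I (agreeOutside-update∷ a) (agreeOutside-update∷ a)
                       (update-≤ᵛ ≤ᵛ-refl S⊆S′) (step-den _) (step-den _)

    step-cont : ∀ {J : Set} (Ss : J → Pred W) → Aleph1Directed Ss → step (⋃ Ss) ⊆ ⋃ (step ∘ Ss)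
    step-cont Ss dir = cont I (update-directedUnion (here refl) (agreeOutside-∷ a) dir)
                         (step-den (⋃ Ss)) (step-den ∘ Ss)

    open FixedPoints step step-mono step-cont public

  mu-continuous : ∀ {X z χ V₀ T₀} → Continuous (z ∷ X) χ (V₀ [ z ↦ T₀ ]) → Continuous X (mu z χ) V₀
  mu-continuous {X} {z} {χ} {V₀} I = record { exists = exists′ ; mono = mono′ ; cont = cont′ }
    where
      open FixedPointBody I

      exists′ : ∀ V → AgreeOutside X V V₀ → ∃ (Den R V (mu z χ))
      exists′ V a = lfp a , Den-cong χ ≐ᵛ-refl (lfp-fixed a) (step-den a (lfp a)) ,
        λ S U d U⊆S → lift (lfp-least a λ w p → U⊆S w (Den-unique χ ≐ᵛ-refl (step-den a S) d w p))

      mono′ : ∀ {V V′ T T′} → AgreeOutside X V V₀ → AgreeOutside X V′ V₀ → V ≤ᵛ V′ →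
              Den R V (mu z χ) T → Den R V′ (mu z χ) T′ → T ⊆ T′
      mono′ {T′ = T′} a a′ V≤V′ (_ , least) (d′ , _) = lower (least T′ _ (step-den a T′)
        (mono I (agreeOutside-update∷ a) (agreeOutside-update∷ a′) (update-≤ᵛ V≤V′ ⊆-refl)
              (step-den a T′) d′))

      cont′ : ∀ {J} {Vs : J → Valuation W} {V∞ T} {D : J → Pred W} → DirectedUnion X V₀ Vs V∞ →
              Den R V∞ (mu z χ) T → (∀ j → Den R (Vs j) (mu z χ) (D j)) → T ⊆ ⋃ D
      cont′ {Vs = Vs} {V∞} {D = D} du (_ , least) Ds = lower (least (⋃ D) _ (step-den a∞ (⋃ D))
        (cont I (directedUnion-update∷ du D-mono ≐-refl) (step-den a∞ (⋃ D)) (proj₁ ∘ Ds)))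
        where
          a∞ : AgreeOutside X V∞ V₀
          a∞ = union-agrees du
          D-mono : ∀ {i j} → Vs i ≤ᵛ Vs j → D i ⊆ D j
          D-mono {i} {j} Vi≤Vj = mono′ (members-agree du i) (members-agree du j) Vi≤Vj (Ds i) (Ds j)

  nu-continuous : ∀ {X z χ V₀ T₀} → Continuous (z ∷ X) χ (V₀ [ z ↦ T₀ ]) → Continuous X (nu z χ) V₀
  nu-continuous {X} {z} {χ} {V₀} I = record { exists = exists′ ; mono = mono′ ; cont = cont′ }
    where
      open FixedPointBody I

      exists′ : ∀ V → AgreeOutside X V V₀ → ∃ (Den R V (nu z χ))
      exists′ V a = gfp a , Den-cong χ ≐ᵛ-refl (gfp-fixed a) (step-den a (gfp a)) ,
        λ S U d S⊆U → lift (post-fixed⊆gfp a λ w p → Den-unique χ ≐ᵛ-refl d (step-den a S) w (S⊆U w p))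

      mono′ : ∀ {V V′ T T′} → AgreeOutside X V V₀ → AgreeOutside X V′ V₀ → V ≤ᵛ V′ →
              Den R V (nu z χ) T → Den R V′ (nu z χ) T′ → T ⊆ T′
      mono′ {T = T} a a′ V≤V′ (d , _) (_ , greatest′) = lower (greatest′ T _ (step-den a′ T)
        (mono I (agreeOutside-update∷ a) (agreeOutside-update∷ a′) (update-≤ᵛ V≤V′ ⊆-refl)
              d (step-den a′ T)))

      cont′ : ∀ {J} {Vs : J → Valuation W} {V∞ T} {D : J → Pred W} → DirectedUnion X V₀ Vs V∞ →
              Den R V∞ (nu z χ) T → (∀ j → Den R (Vs j) (nu z χ) (D j)) → T ⊆ ⋃ D
      cont′ {J} {Vs} {V∞} {T} {D} du (d , _) Ds w w∈T =
        k , lower (proj₂ (Ds k) (range t) _ (step-den (agrees k) (range t)) t⊆step-k) w w∈t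
        where
          agrees : ∀ j → AgreeOutside X (Vs j) V₀
          agrees = members-agree du
          a∞ : AgreeOutside X V∞ V₀
          a∞ = union-agrees du

          cover : gfp a∞ w
          cover = post-fixed⊆gfp a∞ (Den-unique χ ≐ᵛ-refl d (step-den a∞ T)) w w∈T

          t : ℕ → W
          t = proj₁ cover
          w∈t : range t w
          w∈t = proj₁ (proj₂ cover)

          spread : step a∞ (range t) ⊆ ⋃ (λ j → step (agrees j) (range t))
          spread = cont I (directedUnion-update∷ du (λ _ → ⊆-refl) ((λ v p → index du , p) , λ v → proj₂))
                     (step-den a∞ (range t)) (λ j → step-den (agrees j) (range t))

          witness : ∀ n → ⋃ (λ j → step (agrees j) (range t)) (t n)
          witness n = spread (t n) (proj₂ (proj₂ cover) (t n) (n , refl))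

          bound : Σ J λ k → ∀ n → Vs (proj₁ (witness n)) ≤ᵛ Vs k
          bound = directed du ℕ (proj₁ ∘ witness) countable-ℕ
          k : J
          k = proj₁ bound

          t⊆step-k : range t ⊆ step (agrees k) (range t)
          t⊆step-k .(t n) (n , refl) =
            let j = proj₁ (witness n) in
            mono I (agreeOutside-update∷ (agrees j)) (agreeOutside-update∷ (agrees k))
              (update-≤ᵛ (proj₂ bound n) ⊆-refl)
              (step-den (agrees j) (range t)) (step-den (agrees k) (range t))
              (t n) (proj₂ (witness n))

  C₁-continuous : ∀ {X φ V₀ T₀} → C₁ X φ → Den R V₀ φ T₀ → Continuous X φ V₀
  C₁-continuous (c-var _)      _                     = var-continuous
  C₁-continuous (c-ψ _ fresh)  d                     = closed-continuous fresh d
  C₁-continuous c-tt           _                     = tt-continuous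
  C₁-continuous c-ff           _                     = ff-continuous
  C₁-continuous (c-∧ c₁ c₂)    (_ , _ , d₁ , d₂ , _) = ∧-continuous (C₁-continuous c₁ d₁) (C₁-continuous c₂ d₂)
  C₁-continuous (c-∨ c₁ c₂)    (_ , _ , d₁ , d₂ , _) = ∨-continuous (C₁-continuous c₁ d₁) (C₁-continuous c₂ d₂)
  C₁-continuous (c-dia c)      (_ , d , _)           = dia-continuous (C₁-continuous c d)
  C₁-continuous (c-mu c)       (d , _)               = mu-continuous (C₁-continuous c d)
  C₁-continuous (c-nu c)       (d , _)               = nu-continuous (C₁-continuous c d)

proposition5p3 : ∀ {nA : ℕ} (X : List ℕ) (φ : Form nA) → C₁ X φ →
    ∀ (x : ℕ) → x ∈ X → ∀ (M : Model nA) (J : Set) (F : J → Pred (Model.W M)) →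
    Aleph1Directed F →
    ∀ (T : Pred (Model.W M)) (D : J → Pred (Model.W M)) →
    IsDen (M ⟨ x ↦ ⋃ F ⟩) φ T →
    (∀ j → IsDen (M ⟨ x ↦ F j ⟩) φ (D j)) →
    T ≐ ⋃ D
proposition5p3 X φ c x x∈X M J F F-directed T D dT dD =
    cont continuous family dT dD
  , λ w (j , p) → mono continuous (members-agree family j) (union-agrees family)
                    (update-≤ᵛ ≤ᵛ-refl λ v q → j , q) (dD j) dT w p
  where
    open Semantics (Model.R M)
    open Continuous
    open DirectedUnion

    continuous : Continuous X φ (Model.V M [ x ↦ ⋃ F ])
    continuous = C₁-continuous c dT

    family : DirectedUnion X (Model.V M [ x ↦ ⋃ F ]) (λ j → Model.V M [ x ↦ F j ]) (Model.V M [ x ↦ ⋃ F ])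
    family = update-directedUnion x∈X (λ _ _ → ≐-refl) F-directed
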